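{- For every integer $n \ge 9$, $\mathrm{eqdim}(J_{n,3}) \le n-2$.
   Context: For positive integers $n > k$, the Johnson graph $J_{n,k}$ has as vertices all $k$-element subsets of $\{1,\dots,n\}$, two such subsets $A,B$ being adjacent iff $|A \cap B| = k-1$. In a connected graph $G$, $d(u,v)$ is the shortest-path distance. A subset $S \subseteq V(G)$ is a distance-equalizer set of $G$ if for every two distinct vertices $u,v \in V(G)\setminus S$ there exists $x \in S$ with $d(u,x) = d(v,x)$. The equidistant dimension $\mathrm{eqdim}(G)$ is the minimum cardinality of a distance-equalizer set of $G$. -}

module Defs where

open import Data.Nat using (ℕ; zero; suc; _≤_)
open import Data.Fin using (Fin)
open import Data.Fin.Subset using (Subset; ∣_∣; _∩_)
open import Data.Product using (Σ; ∃; ∃-syntax; _×_; proj₁)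
open import Data.List using (List; length)
open import Data.List.Relation.Unary.All using (All)
open import Data.List.Relation.Unary.Any using (Any)
open import Data.List.Relation.Unary.AllPairs using (AllPairs)
open import Relation.Binary.PropositionalEquality using (_≡_; _≢_)
open import Relation.Nullary using (¬_)

JVertex : ℕ → ℕ → Set
JVertex n k = Σ (Subset n) (λ A → ∣ A ∣ ≡ k)

-- Adjacency in J(n,k): |A ∩ B| = k - 1.
JAdj : (n k : ℕ) → JVertex n k → JVertex n k → Set
-- (stated as |A ∩ B| + 1 = k to avoid truncated subtraction)
JAdj n k A B = suc ∣ proj₁ A ∩ proj₁ B ∣ ≡ k

data Walk {V : Set} (E : V → V → Set) : V → V → ℕ → Set where
  here  : ∀ {u} → Walk E u u zero
  step  : ∀ {u w v m} → E u w → Walk E w v m → Walk E u v (suc m)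

Dist : {V : Set} (E : V → V → Set) → V → V → ℕ → Set
Dist E u v m = Walk E u v m × (∀ m′ → Walk E u v m′ → m ≤ m′)

_≈J_ : ∀ {n k} → JVertex n k → JVertex n k → Set
A ≈J B = proj₁ A ≡ proj₁ B

IsDistanceEqualizer : (n k : ℕ) → List (JVertex n k) → Set
IsDistanceEqualizer n k S =
  ∀ (u v : JVertex n k) →
    All (λ x → ¬ (x ≈J u)) S →
    All (λ x → ¬ (x ≈J v)) S →
    ¬ (u ≈J v) →
    Any (λ x → ∃[ m ] (Dist (JAdj n k) u x m × Dist (JAdj n k) v x m)) S

EqdimJ≤ : (n k c : ℕ) → Set
EqdimJ≤ n k c =
  ∃[ S ] (AllPairs (λ x y → ¬ (x ≈J y)) S × length S ≤ c × IsDistanceEqualizer n k S)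

-- In J(n,k) the distance between A and B is k - |A ∩ B|: along an edge |A ∩ B| grows by at most
-- one, and trading an element of A ∖ B for one of B ∖ A makes it grow by exactly one.
-- For n = m + 2 take the m triples {0, 1, j + 2}. A 3-set u outside them meets {0, 1} in α ≤ 1
-- points (α = 2 would make u one of them), and |u ∩ {0, 1, j + 2}| = α + [j + 2 ∈ u]. Given u, v
-- with α + |t| = β + |s| = 3 for their remainders t, s ⊆ {2, …, n-1}: if α = β choose j + 2 outside
-- t ∪ s, possible as |t| + |s| ≤ 6 < m; if α = β + 1 choose j + 2 in s ∖ t, which exists as
-- |s| = |t| + 1. Either way u and v are equidistant from the triple of j.
module Submission where

open import Defs
open import Data.Nat using (ℕ; zero; suc; _+_; _∸_; _≤_; _<_; z≤n; s≤s; s≤s⁻¹; z<s)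
open import Data.Nat.Properties
open import Algebra.Properties.CommutativeSemigroup +-commutativeSemigroup using (interchange; x∙yz≈y∙xz)
open import Data.Bool using (Bool; true; false; _∧_)
open import Data.Bool.Properties using (∧-identityʳ; ∧-zeroʳ)
open import Data.Fin using (Fin; zero; suc)
open import Data.Fin.Subset using (Subset; ∣_∣; _∩_; _∈_; ⊤; ⊥; ⁅_⁆)
open import Data.Fin.Subset.Properties
  using ( ∩-comm; ∩-idem; ∩-identityʳ; ∩-zeroʳ; ∣p∩q∣≤∣p∣; ∣p∩q∣≤∣q∣; ∣p∣≤∣x∷p∣; ∣⊥∣≡0; ∣⁅x⁆∣≡1
        ; x∈⁅x⁆; x∈⁅y⁆⇒x≡y)
open import Data.Vec using (_∷_; []; lookup; _[_]≔_)
open import Data.Vec.Properties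
  using (lookup∘update; lookup∘update′; []≔-idempotent; []≔-lookup; lookup-replicate; ∷-injectiveʳ)
open import Data.Product using (∃-syntax; _×_; _,_; proj₁; map₂)
open import Data.List using (tabulate)
open import Data.List.Properties using (length-tabulate)
import Data.List.Relation.Unary.All.Properties as All
import Data.List.Relation.Unary.Any.Properties as Any
import Data.List.Relation.Unary.AllPairs.Properties as AllPairs
open import Relation.Binary.PropositionalEquality
open import Relation.Nullary using (¬_)
open import Data.Empty using (⊥-elim)
open import Function using (_∘_)

private
  variable
    n k m : ℕ

toℕ : Bool → ℕ
toℕ false = 0
toℕ true  = 1

∣x∷p∣≡[x]+∣p∣ : ∀ x (p : Subset n) → ∣ x ∷ p ∣ ≡ toℕ x + ∣ p ∣
∣x∷p∣≡[x]+∣p∣ false p = refl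
∣x∷p∣≡[x]+∣p∣ true  p = refl

∣x∷y∷p∣ : ∀ x y (p : Subset n) → ∣ x ∷ y ∷ p ∣ ≡ toℕ x + toℕ y + ∣ p ∣
∣x∷y∷p∣ x y p = begin
  ∣ x ∷ y ∷ p ∣              ≡⟨ ∣x∷p∣≡[x]+∣p∣ x (y ∷ p) ⟩
  toℕ x + ∣ y ∷ p ∣          ≡⟨ cong (toℕ x +_) (∣x∷p∣≡[x]+∣p∣ y p) ⟩
  toℕ x + (toℕ y + ∣ p ∣)    ≡⟨ +-assoc (toℕ x) (toℕ y) ∣ p ∣ ⟨
  toℕ x + toℕ y + ∣ p ∣      ∎
  where open ≡-Reasoning

[a∧x]+[a∧b]≤[b∧x]+[a] : ∀ a b x → toℕ (a ∧ x) + toℕ (a ∧ b) ≤ toℕ (b ∧ x) + toℕ a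
[a∧x]+[a∧b]≤[b∧x]+[a] false b     x     = z≤n
[a∧x]+[a∧b]≤[b∧x]+[a] true  false false = z≤n
[a∧x]+[a∧b]≤[b∧x]+[a] true  false true  = s≤s z≤n
[a∧x]+[a∧b]≤[b∧x]+[a] true  true  false = s≤s z≤n
[a∧x]+[a∧b]≤[b∧x]+[a] true  true  true  = s≤s (s≤s z≤n)

-- |p ∩ r| - |q ∩ r| ≤ |p ∖ q|, stated without subtraction.
∣p∩r∣+∣p∩q∣≤∣q∩r∣+∣p∣ : ∀ (p q r : Subset n) → ∣ p ∩ r ∣ + ∣ p ∩ q ∣ ≤ ∣ q ∩ r ∣ + ∣ p ∣
∣p∩r∣+∣p∩q∣≤∣q∩r∣+∣p∣ []      []      []      = z≤n
∣p∩r∣+∣p∩q∣≤∣q∩r∣+∣p∣ (a ∷ p) (b ∷ q) (x ∷ r) = begin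
  ∣ (a ∧ x) ∷ p ∩ r ∣ + ∣ (a ∧ b) ∷ p ∩ q ∣
    ≡⟨ cong₂ _+_ (∣x∷p∣≡[x]+∣p∣ (a ∧ x) (p ∩ r)) (∣x∷p∣≡[x]+∣p∣ (a ∧ b) (p ∩ q)) ⟩
  (toℕ (a ∧ x) + ∣ p ∩ r ∣) + (toℕ (a ∧ b) + ∣ p ∩ q ∣)
    ≡⟨ interchange (toℕ (a ∧ x)) _ _ _ ⟩
  (toℕ (a ∧ x) + toℕ (a ∧ b)) + (∣ p ∩ r ∣ + ∣ p ∩ q ∣)
    ≤⟨ +-mono-≤ ([a∧x]+[a∧b]≤[b∧x]+[a] a b x) (∣p∩r∣+∣p∩q∣≤∣q∩r∣+∣p∣ p q r) ⟩
  (toℕ (b ∧ x) + toℕ a) + (∣ q ∩ r ∣ + ∣ p ∣)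
    ≡⟨ interchange (toℕ (b ∧ x)) _ _ _ ⟩
  (toℕ (b ∧ x) + ∣ q ∩ r ∣) + (toℕ a + ∣ p ∣)
    ≡⟨ cong₂ _+_ (∣x∷p∣≡[x]+∣p∣ (b ∧ x) (q ∩ r)) (∣x∷p∣≡[x]+∣p∣ a p) ⟨
  ∣ (b ∧ x) ∷ q ∩ r ∣ + ∣ a ∷ p ∣ ∎
  where open ≤-Reasoning

∣p∩q∣<∣p∣⇒∃p∖q : ∀ (p q : Subset n) → ∣ p ∩ q ∣ < ∣ p ∣ → ∃[ i ] lookup p i ≡ true × lookup q i ≡ false
∣p∩q∣<∣p∣⇒∃p∖q (true  ∷ p) (false ∷ q) _       = zero , refl , refl
∣p∩q∣<∣p∣⇒∃p∖q (true  ∷ p) (true  ∷ q) (s≤s h)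
  with i , p!i , q!i ← ∣p∩q∣<∣p∣⇒∃p∖q p q h = suc i , p!i , q!i
∣p∩q∣<∣p∣⇒∃p∖q (false ∷ p) (b     ∷ q) h
  with i , p!i , q!i ← ∣p∩q∣<∣p∣⇒∃p∖q p q h = suc i , p!i , q!i

∣q∣<∣p∣⇒∃p∖q : ∀ (p q : Subset n) → ∣ q ∣ < ∣ p ∣ → ∃[ i ] lookup p i ≡ true × lookup q i ≡ false
∣q∣<∣p∣⇒∃p∖q p q ∣q∣<∣p∣ = ∣p∩q∣<∣p∣⇒∃p∖q p q (≤-<-trans (∣p∩q∣≤∣q∣ p q) ∣q∣<∣p∣)

∣p∣+∣q∣<n⇒∃∉p∪q : ∀ (p q : Subset n) → ∣ p ∣ + ∣ q ∣ < n → ∃[ i ] lookup p i ≡ false × lookup q i ≡ false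
∣p∣+∣q∣<n⇒∃∉p∪q (false ∷ p) (false ∷ q) _ = zero , refl , refl
∣p∣+∣q∣<n⇒∃∉p∪q (true  ∷ p) (b     ∷ q) h
  with i , p!i , q!i ← ∣p∣+∣q∣<n⇒∃∉p∪q p q (≤-trans (s≤s (+-monoʳ-≤ ∣ p ∣ (∣p∣≤∣x∷p∣ b q))) (s≤s⁻¹ h))
  = suc i , p!i , q!i
∣p∣+∣q∣<n⇒∃∉p∪q (false ∷ p) (true  ∷ q) h
  with i , p!i , q!i ← ∣p∣+∣q∣<n⇒∃∉p∪q p q (s≤s⁻¹ (≤-trans (≤-reflexive (cong suc (sym (+-suc ∣ p ∣ ∣ q ∣)))) h))
  = suc i , p!i , q!i

∣p∩q∣≡∣p∣⇒p∩q≡p : ∀ (p q : Subset n) → ∣ p ∩ q ∣ ≡ ∣ p ∣ → p ∩ q ≡ p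
∣p∩q∣≡∣p∣⇒p∩q≡p []          []          _ = refl
∣p∩q∣≡∣p∣⇒p∩q≡p (true  ∷ p) (true  ∷ q) h = cong (true ∷_) (∣p∩q∣≡∣p∣⇒p∩q≡p p q (suc-injective h))
∣p∩q∣≡∣p∣⇒p∩q≡p (false ∷ p) (b     ∷ q) h = cong (false ∷_) (∣p∩q∣≡∣p∣⇒p∩q≡p p q h)
∣p∩q∣≡∣p∣⇒p∩q≡p (true  ∷ p) (false ∷ q) h = ⊥-elim (<-irrefl h (s≤s (∣p∩q∣≤∣p∣ p q)))

∣p∩⁅i⁆∣≡[p!i] : ∀ (p : Subset n) i → ∣ p ∩ ⁅ i ⁆ ∣ ≡ toℕ (lookup p i)
∣p∩⁅i⁆∣≡[p!i] {suc n} (x ∷ p) zero = begin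
  ∣ (x ∧ true) ∷ p ∩ ⊥ ∣  ≡⟨ ∣x∷p∣≡[x]+∣p∣ (x ∧ true) (p ∩ ⊥) ⟩
  toℕ (x ∧ true) + ∣ p ∩ ⊥ ∣  ≡⟨ cong₂ (λ a q → toℕ a + ∣ q ∣) (∧-identityʳ x) (∩-zeroʳ p) ⟩
  toℕ x + ∣ ⊥ {n} ∣  ≡⟨ cong (toℕ x +_) (∣⊥∣≡0 n) ⟩
  toℕ x + 0  ≡⟨ +-identityʳ (toℕ x) ⟩
  toℕ x  ∎
  where open ≡-Reasoning
∣p∩⁅i⁆∣≡[p!i] (x ∷ p) (suc i) = trans (cong (λ a → ∣ a ∷ p ∩ ⁅ i ⁆ ∣) (∧-zeroʳ x)) (∣p∩⁅i⁆∣≡[p!i] p i)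

∣p∣≡1⇒p≡⁅i⁆ : ∀ (p : Subset n) → ∣ p ∣ ≡ 1 → ∃[ i ] p ≡ ⁅ i ⁆
∣p∣≡1⇒p≡⁅i⁆ (true  ∷ p) ∣p∣≡1 = zero , cong (true ∷_) (∣p∣≡0⇒p≡⊥ p (suc-injective ∣p∣≡1))
  where
  ∣p∣≡0⇒p≡⊥ : ∀ {n} (p : Subset n) → ∣ p ∣ ≡ 0 → p ≡ ⊥
  ∣p∣≡0⇒p≡⊥ []          _ = refl
  ∣p∣≡0⇒p≡⊥ (false ∷ p) h = cong (false ∷_) (∣p∣≡0⇒p≡⊥ p h)
∣p∣≡1⇒p≡⁅i⁆ (false ∷ p) ∣p∣≡1 with i , p≡⁅i⁆ ← ∣p∣≡1⇒p≡⁅i⁆ p ∣p∣≡1 = suc i , cong (false ∷_) p≡⁅i⁆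

∣p∩r∣≡[r!i]+∣p[i]≔false∩r∣ : ∀ (p r : Subset n) i → lookup p i ≡ true →
                              ∣ p ∩ r ∣ ≡ toℕ (lookup r i) + ∣ (p [ i ]≔ false) ∩ r ∣
∣p∩r∣≡[r!i]+∣p[i]≔false∩r∣ (true ∷ p) (x ∷ r) zero    refl = ∣x∷p∣≡[x]+∣p∣ x (p ∩ r)
∣p∩r∣≡[r!i]+∣p[i]≔false∩r∣ (a ∷ p)    (x ∷ r) (suc i) p!i  = begin
  ∣ (a ∧ x) ∷ p ∩ r ∣             ≡⟨ ∣x∷p∣≡[x]+∣p∣ (a ∧ x) (p ∩ r) ⟩
  toℕ (a ∧ x) + ∣ p ∩ r ∣         ≡⟨ cong (toℕ (a ∧ x) +_) (∣p∩r∣≡[r!i]+∣p[i]≔false∩r∣ p r i p!i) ⟩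
  toℕ (a ∧ x) + (ri + ∣ p′ ∩ r ∣) ≡⟨ x∙yz≈y∙xz (toℕ (a ∧ x)) ri _ ⟩
  ri + (toℕ (a ∧ x) + ∣ p′ ∩ r ∣) ≡⟨ cong (ri +_) (∣x∷p∣≡[x]+∣p∣ (a ∧ x) (p′ ∩ r)) ⟨
  ri + ∣ (a ∧ x) ∷ p′ ∩ r ∣       ∎
  where
  open ≡-Reasoning
  ri = toℕ (lookup r i)
  p′ = p [ i ]≔ false

swap : Subset n → Fin n → Fin n → Subset n
swap p i j = (p [ i ]≔ false) [ j ]≔ true

∣swap∩r∣ : ∀ (p r : Subset n) {i j a b} → lookup p i ≡ true → lookup p j ≡ false →
           lookup r i ≡ a → lookup r j ≡ b → toℕ a + ∣ swap p i j ∩ r ∣ ≡ toℕ b + ∣ p ∩ r ∣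
∣swap∩r∣ p r {i} {j} p!i p!j refl refl = begin
  ri + ∣ q ∩ r ∣
    ≡⟨ cong (ri +_) (∣p∩r∣≡[r!i]+∣p[i]≔false∩r∣ q r j (lookup∘update j p′ true)) ⟩
  ri + (rj + ∣ (q [ j ]≔ false) ∩ r ∣)
    ≡⟨ cong (λ x → ri + (rj + ∣ x ∩ r ∣)) q[j]≔false≡p′ ⟩
  ri + (rj + ∣ p′ ∩ r ∣)
    ≡⟨ x∙yz≈y∙xz ri rj _ ⟩
  rj + (ri + ∣ p′ ∩ r ∣)
    ≡⟨ cong (rj +_) (∣p∩r∣≡[r!i]+∣p[i]≔false∩r∣ p r i p!i) ⟨
  rj + ∣ p ∩ r ∣ ∎
  where
  open ≡-Reasoning
  ri = toℕ (lookup r i)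
  rj = toℕ (lookup r j)
  p′ = p [ i ]≔ false
  q = p′ [ j ]≔ true
  j≢i : j ≢ i
  j≢i refl with () ← trans (sym p!i) p!j
  q[j]≔false≡p′ : q [ j ]≔ false ≡ p′
  q[j]≔false≡p′ = begin
    q [ j ]≔ false             ≡⟨ []≔-idempotent p′ j ⟩
    p′ [ j ]≔ false            ≡⟨ cong (p′ [ j ]≔_) (trans (lookup∘update′ j≢i p false) p!j) ⟨
    p′ [ j ]≔ lookup p′ j      ≡⟨ []≔-lookup p′ j ⟩
    p′                         ∎

exchange : ∀ (p q : Subset n) → ∣ p ∩ q ∣ < ∣ p ∣ → ∣ p ∣ ≡ ∣ q ∣ →
           ∃[ r ] ∣ r ∣ ≡ ∣ p ∣ × suc ∣ p ∩ r ∣ ≡ ∣ p ∣ × ∣ r ∩ q ∣ ≡ suc ∣ p ∩ q ∣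
exchange p q ∣p∩q∣<∣p∣ ∣p∣≡∣q∣
  with i , p!i , q!i ← ∣p∩q∣<∣p∣⇒∃p∖q p q ∣p∩q∣<∣p∣
     | j , q!j , p!j ← ∣p∩q∣<∣p∣⇒∃p∖q q p (subst₂ _<_ (cong ∣_∣ (∩-comm p q)) ∣p∣≡∣q∣ ∣p∩q∣<∣p∣)
  = r , ∣r∣≡∣p∣ , ∣p∩r∣ , ∣swap∩r∣ p q p!i p!j q!i q!j
  where
  r = swap p i j
  ∣r∣≡∣p∣ : ∣ r ∣ ≡ ∣ p ∣
  ∣r∣≡∣p∣ = begin
    ∣ r ∣      ≡⟨ cong ∣_∣ (∩-identityʳ r) ⟨
    ∣ r ∩ ⊤ ∣  ≡⟨ suc-injective (∣swap∩r∣ p ⊤ p!i p!j (lookup-replicate i true) (lookup-replicate j true)) ⟩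
    ∣ p ∩ ⊤ ∣  ≡⟨ cong ∣_∣ (∩-identityʳ p) ⟩
    ∣ p ∣      ∎
    where open ≡-Reasoning
  ∣p∩r∣ : suc ∣ p ∩ r ∣ ≡ ∣ p ∣
  ∣p∩r∣ = begin
    suc ∣ p ∩ r ∣ ≡⟨ cong (suc ∘ ∣_∣) (∩-comm p r) ⟩
    suc ∣ r ∩ p ∣ ≡⟨ ∣swap∩r∣ p p p!i p!j p!i p!j ⟩
    ∣ p ∩ p ∣     ≡⟨ cong ∣_∣ (∩-idem p) ⟩
    ∣ p ∣         ∎
    where open ≡-Reasoning

≈J⇒≡ : {A B : JVertex n k} → A ≈J B → A ≡ B
≈J⇒≡ {A = p , e} {B = .p , e′} refl = cong (p ,_) (≡-irrelevant e e′)

module _ {n k : ℕ} where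

  infix 7 _∩ᴶ_

  _∩ᴶ_ : JVertex n k → JVertex n k → ℕ
  A ∩ᴶ B = ∣ proj₁ A ∩ proj₁ B ∣

  ∩ᴶ≡k⇒≈J : (A B : JVertex n k) → A ∩ᴶ B ≡ k → A ≈J B
  ∩ᴶ≡k⇒≈J (p , ∣p∣≡k) (q , ∣q∣≡k) h = begin
    p      ≡⟨ ∣p∩q∣≡∣p∣⇒p∩q≡p p q (trans h (sym ∣p∣≡k)) ⟨
    p ∩ q  ≡⟨ ∩-comm p q ⟩
    q ∩ p  ≡⟨ ∣p∩q∣≡∣p∣⇒p∩q≡p q p (trans (cong ∣_∣ (∩-comm q p)) (trans h (sym ∣q∣≡k))) ⟩
    q      ∎
    where open ≡-Reasoning

  adjacent⇒∣∩∣≤suc : ∀ {A C : JVertex n k} (r : Subset n) → JAdj n k A C →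
                     ∣ proj₁ C ∩ r ∣ ≤ suc ∣ proj₁ A ∩ r ∣
  adjacent⇒∣∩∣≤suc {p , _} {q , ∣q∣≡k} r adj = +-cancelʳ-≤ ∣ q ∩ p ∣ _ _ (begin
    ∣ q ∩ r ∣ + ∣ q ∩ p ∣        ≤⟨ ∣p∩r∣+∣p∩q∣≤∣q∩r∣+∣p∣ q p r ⟩
    ∣ p ∩ r ∣ + ∣ q ∣            ≡⟨ cong (∣ p ∩ r ∣ +_) (trans ∣q∣≡k (sym adj)) ⟩
    ∣ p ∩ r ∣ + suc ∣ p ∩ q ∣    ≡⟨ +-suc ∣ p ∩ r ∣ _ ⟩
    suc ∣ p ∩ r ∣ + ∣ p ∩ q ∣    ≡⟨ cong (λ x → suc ∣ p ∩ r ∣ + ∣ x ∣) (∩-comm p q) ⟩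
    suc ∣ p ∩ r ∣ + ∣ q ∩ p ∣    ∎)
    where open ≤-Reasoning

  walk⇒k≤∩ᴶ+length : ∀ {A B : JVertex n k} {d} → Walk (JAdj n k) A B d → k ≤ A ∩ᴶ B + d
  walk⇒k≤∩ᴶ+length {p , ∣p∣≡k} here = begin
    k              ≡⟨ ∣p∣≡k ⟨
    ∣ p ∣          ≡⟨ cong ∣_∣ (∩-idem p) ⟨
    ∣ p ∩ p ∣      ≡⟨ +-identityʳ _ ⟨
    ∣ p ∩ p ∣ + 0  ∎
    where open ≤-Reasoning
  walk⇒k≤∩ᴶ+length {A} {B} {suc d} (step {w = C} adj walk) = begin
    k                   ≤⟨ walk⇒k≤∩ᴶ+length walk ⟩
    C ∩ᴶ B + d          ≤⟨ +-monoˡ-≤ d (adjacent⇒∣∩∣≤suc {A} {C} (proj₁ B) adj) ⟩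
    suc (A ∩ᴶ B) + d    ≡⟨ +-suc (A ∩ᴶ B) d ⟨
    A ∩ᴶ B + suc d      ∎
    where open ≤-Reasoning

  walk-of-length : ∀ d (A B : JVertex n k) → A ∩ᴶ B + d ≡ k → Walk (JAdj n k) A B d
  walk-of-length zero    A B h =
    subst (λ B → Walk (JAdj n k) A B 0) (≈J⇒≡ (∩ᴶ≡k⇒≈J A B (trans (sym (+-identityʳ _)) h))) here
  walk-of-length (suc d) (p , ∣p∣≡k) (q , ∣q∣≡k) h
    with r , ∣r∣≡∣p∣ , ∣p∩r∣ , ∣r∩q∣ ← exchange p q (subst (∣ p ∩ q ∣ <_) (trans h (sym ∣p∣≡k)) (m<m+n _ z<s))
                                                      (trans ∣p∣≡k (sym ∣q∣≡k))
    = step (trans ∣p∩r∣ ∣p∣≡k) (walk-of-length d (r , trans ∣r∣≡∣p∣ ∣p∣≡k) (q , ∣q∣≡k) (begin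
        ∣ r ∩ q ∣ + d        ≡⟨ cong (_+ d) ∣r∩q∣ ⟩
        suc ∣ p ∩ q ∣ + d    ≡⟨ +-suc ∣ p ∩ q ∣ d ⟨
        ∣ p ∩ q ∣ + suc d    ≡⟨ h ⟩
        k                    ∎))
    where open ≡-Reasoning

  distance : (A B : JVertex n k) → Dist (JAdj n k) A B (k ∸ A ∩ᴶ B)
  distance A@(p , ∣p∣≡k) B =
      walk-of-length _ A B (m+[n∸m]≡n (subst (A ∩ᴶ B ≤_) ∣p∣≡k (∣p∩q∣≤∣p∣ p (proj₁ B))))
    , λ d walk → m≤n+o⇒m∸n≤o k (A ∩ᴶ B) (walk⇒k≤∩ᴶ+length walk)

  equidistant : {u v x : JVertex n k} → u ∩ᴶ x ≡ v ∩ᴶ x →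
                ∃[ d ] Dist (JAdj n k) u x d × Dist (JAdj n k) v x d
  equidistant {u} {v} {x} eq =
    k ∸ u ∩ᴶ x , distance u x , subst (λ c → Dist (JAdj n k) v x (k ∸ c)) (sym eq) (distance v x)

common-gap : ∀ α (t s : Subset n) → ∣ t ∣ + ∣ s ∣ < n →
             ∃[ i ] α + toℕ (lookup t i) ≡ α + toℕ (lookup s i)
common-gap α t s small with i , t!i , s!i ← ∣p∣+∣q∣<n⇒∃∉p∪q t s small
  = i , cong (λ x → α + toℕ x) (trans t!i (sym s!i))

equalizing-index : ∀ α β (t s : Subset n) → α + ∣ t ∣ ≡ β + ∣ s ∣ → ∣ t ∣ + ∣ s ∣ < n →
                   α ≤ 1 → β ≤ 1 → ∃[ i ] α + toℕ (lookup t i) ≡ β + toℕ (lookup s i)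
equalizing-index 0 0 t s _ small _ _ = common-gap 0 t s small
equalizing-index 1 1 t s _ small _ _ = common-gap 1 t s small
equalizing-index 0 1 t s ∣t∣≡1+∣s∣ _ _ _
  with i , t!i , s!i ← ∣q∣<∣p∣⇒∃p∖q t s (≤-reflexive (sym ∣t∣≡1+∣s∣))
  = i , subst₂ (λ a b → toℕ a ≡ 1 + toℕ b) (sym t!i) (sym s!i) refl
equalizing-index 1 0 t s 1+∣t∣≡∣s∣ _ _ _
  with i , s!i , t!i ← ∣q∣<∣p∣⇒∃p∖q s t (≤-reflexive 1+∣t∣≡∣s∣)
  = i , subst₂ (λ a b → 1 + toℕ a ≡ toℕ b) (sym t!i) (sym s!i) refl
equalizing-index (suc (suc _)) _ _ _ _ _ (s≤s ()) _
equalizing-index _ (suc (suc _)) _ _ _ _ _ (s≤s ())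

triple₀₁ : Fin m → JVertex (2 + m) 3
triple₀₁ j = true ∷ true ∷ ⁅ j ⁆ , cong (2 +_) (∣⁅x⁆∣≡1 j)

triple₀₁-injective : ∀ {i j : Fin m} → i ≢ j → ¬ triple₀₁ i ≈J triple₀₁ j
triple₀₁-injective {i = i} {j} i≢j eq =
  i≢j (x∈⁅y⁆⇒x≡y j (subst (i ∈_) (∷-injectiveʳ (∷-injectiveʳ eq)) (x∈⁅x⁆ i)))

∣∷∷∩triple₀₁∣ : ∀ a b (t : Subset m) j →
                ∣ (a ∷ b ∷ t) ∩ proj₁ (triple₀₁ j) ∣ ≡ toℕ a + toℕ b + toℕ (lookup t j)
∣∷∷∩triple₀₁∣ a b t j = begin
  ∣ (a ∧ true) ∷ (b ∧ true) ∷ t ∩ ⁅ j ⁆ ∣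
    ≡⟨ ∣x∷y∷p∣ (a ∧ true) (b ∧ true) (t ∩ ⁅ j ⁆) ⟩
  toℕ (a ∧ true) + toℕ (b ∧ true) + ∣ t ∩ ⁅ j ⁆ ∣
    ≡⟨ cong₂ (λ x y → toℕ x + toℕ y + ∣ t ∩ ⁅ j ⁆ ∣) (∧-identityʳ a) (∧-identityʳ b) ⟩
  toℕ a + toℕ b + ∣ t ∩ ⁅ j ⁆ ∣
    ≡⟨ cong (toℕ a + toℕ b +_) (∣p∩⁅i⁆∣≡[p!i] t j) ⟩
  toℕ a + toℕ b + toℕ (lookup t j) ∎
  where open ≡-Reasoning

off-triples⇒[a]+[b]≤1 : ∀ a b (t : Subset m) → toℕ a + toℕ b + ∣ t ∣ ≡ 3 →
                        (∀ j → true ∷ true ∷ ⁅ j ⁆ ≢ a ∷ b ∷ t) → toℕ a + toℕ b ≤ 1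
off-triples⇒[a]+[b]≤1 false false _ _ _ = z≤n
off-triples⇒[a]+[b]≤1 false true  _ _ _ = ≤-refl
off-triples⇒[a]+[b]≤1 true  false _ _ _ = ≤-refl
off-triples⇒[a]+[b]≤1 true  true  t ∣t∣+2≡3 ∉triples
  with j , t≡⁅j⁆ ← ∣p∣≡1⇒p≡⁅i⁆ t (suc-injective (suc-injective ∣t∣+2≡3))
  = ⊥-elim (∉triples j (cong (λ q → true ∷ true ∷ q) (sym t≡⁅j⁆)))

off-triples⇒∃equal-meet : 7 ≤ m → (u v : JVertex (2 + m) 3) →
                          (∀ j → ¬ triple₀₁ j ≈J u) → (∀ j → ¬ triple₀₁ j ≈J v) →
                          ∃[ j ] u ∩ᴶ triple₀₁ j ≡ v ∩ᴶ triple₀₁ j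
off-triples⇒∃equal-meet {m} 7≤m (a ∷ b ∷ t , ∣u∣≡3) (c ∷ d ∷ s , ∣v∣≡3) u∉S v∉S =
  map₂ (λ {j} α+[t!j]≡β+[s!j] → begin
    ∣ (a ∷ b ∷ t) ∩ proj₁ (triple₀₁ j) ∣   ≡⟨ ∣∷∷∩triple₀₁∣ a b t j ⟩
    α + toℕ (lookup t j)                   ≡⟨ α+[t!j]≡β+[s!j] ⟩
    β + toℕ (lookup s j)                   ≡⟨ ∣∷∷∩triple₀₁∣ c d s j ⟨
    ∣ (c ∷ d ∷ s) ∩ proj₁ (triple₀₁ j) ∣   ∎)
  (equalizing-index α β t s (trans α+∣t∣≡3 (sym β+∣s∣≡3)) ∣t∣+∣s∣<m
     (off-triples⇒[a]+[b]≤1 a b t α+∣t∣≡3 u∉S) (off-triples⇒[a]+[b]≤1 c d s β+∣s∣≡3 v∉S))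
  where
  open ≡-Reasoning
  α = toℕ a + toℕ b
  β = toℕ c + toℕ d
  α+∣t∣≡3 : α + ∣ t ∣ ≡ 3
  α+∣t∣≡3 = trans (sym (∣x∷y∷p∣ a b t)) ∣u∣≡3
  β+∣s∣≡3 : β + ∣ s ∣ ≡ 3
  β+∣s∣≡3 = trans (sym (∣x∷y∷p∣ c d s)) ∣v∣≡3
  ∣t∣+∣s∣<m : ∣ t ∣ + ∣ s ∣ < m
  ∣t∣+∣s∣<m = ≤-trans (s≤s (+-mono-≤ (subst (∣ t ∣ ≤_) α+∣t∣≡3 (m≤n+m ∣ t ∣ α))
                                       (subst (∣ s ∣ ≤_) β+∣s∣≡3 (m≤n+m ∣ s ∣ β)))) 7≤m

triples₀₁-equalize : 7 ≤ m → IsDistanceEqualizer (2 + m) 3 (tabulate triple₀₁)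
triples₀₁-equalize 7≤m u v u∉S v∉S _
  with j , u∩x≡v∩x ← off-triples⇒∃equal-meet 7≤m u v (All.tabulate⁻ u∉S) (All.tabulate⁻ v∉S)
  = Any.tabulate⁺ j (equidistant {u = u} {v} {triple₀₁ j} u∩x≡v∩x)

theorem4 : ∀ (n : ℕ) → 9 ≤ n → EqdimJ≤ n 3 (n ∸ 2)
theorem4 (suc (suc m)) (s≤s (s≤s 7≤m)) =
    tabulate triple₀₁
  , AllPairs.tabulate⁺ triple₀₁-injective
  , ≤-reflexive (length-tabulate triple₀₁)
  , triples₀₁-equalize 7≤m
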